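{- Let $G=(V,E)$ be a simple graph with integer edge weights in $\{1,\dots,W\}$, let $\beta\geq 3$ and $\beta^-\leq\beta-2$ be integers, and let $H$ be a $(\beta,\beta^-)$-$w$-EDCS of $G$. Then $\deg_H(v) \leq \beta$ for all $v \in V$.
   Context: For a subgraph $H$ of $G$ and $v\in V$, $N_H(v)$ is the set of neighbours of $v$ in $H$, $\deg_H(v)=|N_H(v)|$, and $\mathbf{w}\!\deg_H(v)=\sum_{u\in N_H(v)}w(u,v)$, where $w(u,v)$ is the weight of edge $(u,v)$. For integers $\beta\geq 3$ and $\beta^-\leq\beta-2$, a subgraph $H$ of $G$ is a $(\beta,\beta^-)$-$w$-EDCS of $G$ if (i) for every edge $(u,v)\in H$, $\mathbf{w}\!\deg_H(u)+\mathbf{w}\!\deg_H(v)\leq\beta\cdot w(u,v)$, and (ii) for every edge $(u,v)\in G\setminus H$, $\mathbf{w}\!\deg_H(u)+\mathbf{w}\!\deg_H(v)\geq\beta^-\cdot w(u,v)$. -}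

module Defs where

open import Data.Nat using (ℕ; zero; suc; _+_; _*_; _≤_)
open import Data.Integer as ℤ using (ℤ; +_)
open import Data.Bool using (Bool; true; false; if_then_else_; T)
open import Data.Fin using (Fin)
open import Data.List using (List; map; allFin)
open import Data.Nat.ListAction using (sum)
open import Relation.Binary.PropositionalEquality using (_≡_)
open import Data.Product using (_×_)
open import Relation.Nullary using (¬_)

EdgeSet : ℕ → Set
EdgeSet n = Fin n → Fin n → Bool

-- weight function on pairs of vertices (only relevant on edges)
Weight : ℕ → Set
Weight n = Fin n → Fin n → ℕ

IsSimpleGraph : ∀ {n} → EdgeSet n → Set
IsSimpleGraph {n} E = (∀ u v → T (E u v) → T (E v u)) × (∀ v → ¬ T (E v v))

IsWeighting : ∀ {n} → ℕ → EdgeSet n → Weight n → Set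
IsWeighting {n} W E w =
  ∀ u v → T (E u v) → (1 ≤ w u v) × (w u v ≤ W) × (w u v ≡ w v u)

IsSubgraph : ∀ {n} → EdgeSet n → EdgeSet n → Set
IsSubgraph {n} H E = (∀ u v → T (H u v) → T (E u v)) × (∀ u v → T (H u v) → T (H v u))

deg : ∀ {n} → EdgeSet n → Fin n → ℕ
deg {n} H v = sum (map (λ u → if H u v then 1 else 0) (allFin n))

wdeg : ∀ {n} → EdgeSet n → Weight n → Fin n → ℕ
wdeg {n} H w v = sum (map (λ u → if H u v then w u v else 0) (allFin n))

IsWEDCS : ∀ {n} → ℕ → ℤ → EdgeSet n → Weight n → EdgeSet n → Set
IsWEDCS {n} β β⁻ E w H =
  IsSubgraph H E
  × (∀ u v → T (H u v) → wdeg H w u + wdeg H w v ≤ β * w u v)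
  × (∀ u v → T (E u v) → ¬ T (H u v) →
       β⁻ ℤ.* (+ w u v) ℤ.≤ + (wdeg H w u + wdeg H w v))

{-# OPTIONS --safe #-}
module Submission where

-- Every H-neighbour u of v satisfies wdeg_H(v) ≤ wdeg_H(u) + wdeg_H(v) ≤ β·w(u,v) by
-- condition (i).  Summing over the neighbours gives wdeg_H(v)·deg_H(v) ≤ β·wdeg_H(v), and
-- since all weights are at least 1 we may cancel wdeg_H(v) unless it is 0, in which case
-- deg_H(v) ≤ wdeg_H(v) = 0.

open import Defs
open import Data.Nat using (ℕ; zero; suc; _+_; _*_; _≤_; z≤n)
open import Data.Nat.Properties
open import Data.Nat.ListAction using (sum)
open import Data.Integer using (ℤ; +_; _-_)
open import Data.Fin using (Fin)
open import Data.List using ([]; _∷_; map; allFin)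
open import Data.Bool using (true; false; if_then_else_; T)
open import Data.Unit using (tt)
open import Data.Product using (_,_; proj₁; proj₂)
open import Relation.Binary.PropositionalEquality using (_≡_; refl; sym; subst; subst₂)

sum-map-mono-≤ : ∀ {a} {A : Set a} {f g : A → ℕ} → (∀ x → f x ≤ g x) →
                 ∀ xs → sum (map f xs) ≤ sum (map g xs)
sum-map-mono-≤ f≤g []       = z≤n
sum-map-mono-≤ f≤g (x ∷ xs) = +-mono-≤ (f≤g x) (sum-map-mono-≤ f≤g xs)

sum-map-*ˡ : ∀ {a} {A : Set a} (c : ℕ) (f : A → ℕ) xs →
             sum (map (λ x → c * f x) xs) ≡ c * sum (map f xs)
sum-map-*ˡ c f []       = sym (*-zeroʳ c)
sum-map-*ˡ c f (x ∷ xs) rewrite sum-map-*ˡ c f xs = sym (*-distribˡ-+ c (f x) _)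

if-mono-≤ : ∀ b {x y : ℕ} → (T b → x ≤ y) → (if b then x else 0) ≤ (if b then y else 0)
if-mono-≤ true  x≤y = x≤y tt
if-mono-≤ false _   = z≤n

*-distribˡ-if : ∀ m b x → m * (if b then x else 0) ≡ (if b then m * x else 0)
*-distribˡ-if m true  x = refl
*-distribˡ-if m false x = *-zeroʳ m

≤-cancel-factor : ∀ {d b m} → d ≤ m → m * d ≤ b * m → d ≤ b
≤-cancel-factor {m = zero}  d≤0 _ = ≤-trans d≤0 z≤n
≤-cancel-factor {d} {b} {m = suc k} _ md≤bm =
  *-cancelˡ-≤ (suc k) (subst (suc k * d ≤_) (*-comm b (suc k)) md≤bm)

module _ {n} (H : EdgeSet n) (w : Weight n) (v : Fin n) where

  deg≤wdeg : (∀ u → T (H u v) → 1 ≤ w u v) → deg H v ≤ wdeg H w v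
  deg≤wdeg w≥1 = sum-map-mono-≤ (λ u → if-mono-≤ (H u v) (w≥1 u)) (allFin n)

  wdeg*deg≤β*wdeg : ∀ β → (∀ u → T (H u v) → wdeg H w v ≤ β * w u v) →
                    wdeg H w v * deg H v ≤ β * wdeg H w v
  wdeg*deg≤β*wdeg β bound = begin
    wdeg H w v * deg H v                      ≡⟨ sum-map-*ˡ (wdeg H w v) edge (allFin n) ⟨
    sum (map (λ u → wdeg H w v * edge u) (allFin n)) ≤⟨ sum-map-mono-≤ pointwise (allFin n) ⟩
    sum (map (λ u → β * weight u) (allFin n))  ≡⟨ sum-map-*ˡ β weight (allFin n) ⟩
    β * wdeg H w v                            ∎
    where
    open ≤-Reasoning
    edge weight : Fin n → ℕ
    edge   u = if H u v then 1 else 0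
    weight u = if H u v then w u v else 0
    pointwise : ∀ u → wdeg H w v * edge u ≤ β * weight u
    pointwise u = subst₂ _≤_ (sym (*-distribˡ-if (wdeg H w v) (H u v) 1))
                             (sym (*-distribˡ-if β (H u v) (w u v)))
                    (if-mono-≤ (H u v) λ huv → ≤-trans (≤-reflexive (*-identityʳ _)) (bound u huv))

  deg≤-if-wdeg≤ : ∀ β → (∀ u → T (H u v) → 1 ≤ w u v) →
                  (∀ u → T (H u v) → wdeg H w v ≤ β * w u v) → deg H v ≤ β
  deg≤-if-wdeg≤ β w≥1 bound = ≤-cancel-factor (deg≤wdeg w≥1) (wdeg*deg≤β*wdeg β bound)

module _ {n} (W : ℕ) {E H : EdgeSet n} {w : Weight n}
         (weighting : IsWeighting W E w) (subgraph : IsSubgraph H E) where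

  private
    H⊆E   = proj₁ subgraph
    H-sym = proj₂ subgraph

  subgraph-weight≥1 : ∀ v u → T (H u v) → 1 ≤ w u v
  subgraph-weight≥1 v u huv = proj₁ (weighting u v (H⊆E u v huv))

  wdeg≤β*weight : ∀ β → (∀ u v → T (H u v) → wdeg H w u + wdeg H w v ≤ β * w u v) →
                  ∀ v u → T (H u v) → wdeg H w v ≤ β * w u v
  wdeg≤β*weight β edge-bound v u huv =
    subst (λ k → wdeg H w v ≤ β * k) (sym (proj₂ (proj₂ (weighting u v (H⊆E u v huv)))))
      (≤-trans (m≤m+n (wdeg H w v) (wdeg H w u)) (edge-bound v u (H-sym u v huv)))

proposition8 : (n W β : ℕ) (β⁻ : ℤ) (E : EdgeSet n) (w : Weight n) (H : EdgeSet n)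
    → IsSimpleGraph E → IsWeighting W E w
    → 3 ≤ β → β⁻ Data.Integer.≤ (+ β - + 2)
    → IsWEDCS β β⁻ E w H
    → ∀ (v : Fin n) → deg H v ≤ β
proposition8 n W β β⁻ E w H _ weighting _ _ (subgraph , edge-bound , _) v =
  deg≤-if-wdeg≤ H w v β (subgraph-weight≥1 W weighting subgraph v)
                        (wdeg≤β*weight W weighting subgraph β edge-bound v)
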